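{- Let $V_1,V_2$ be disjoint finite sets and $\mathcal{H}^1\subseteq 2^{V_1}$, $\mathcal{H}^2\subseteq 2^{V_2}$ hypergraphs satisfying property (A). Then $\mathcal{H}=\mathcal{H}^1\otimes\mathcal{H}^2$ also satisfies property (A).
   Context: A hypergraph on a finite set $V$ is a family $\mathcal{H}\subseteq 2^V$ of nonempty edges covering $V$. An edge is transversal if it meets every edge; $\mathcal{H}_S=\{H\in\mathcal{H}\mid H\subseteq S\}$. Property (A): $\mathcal{H}$ has no transversal edge, but for every proper $S\subsetneq V$ with $\mathcal{H}_S\neq\emptyset$, $\mathcal{H}_S$ has an edge meeting all edges of $\mathcal{H}_S$. Conjunctive compound: $\mathcal{H}^1\otimes\mathcal{H}^2=\{H^1\cup H^2\mid H^1\in\mathcal{H}^1,H^2\in\mathcal{H}^2\}$, a hypergraph on $V_1\cup V_2$. -}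

module Defs where

open import Data.Nat using (ℕ)
open import Data.Fin using (Fin)
open import Data.Fin.Subset using (Subset; _∈_; _⊆_; _∩_; _∪_; Nonempty)
open import Data.List using (List; concatMap; map)
open import Data.Product using (Σ; ∃; _×_)
open import Relation.Nullary using (¬_)
open import Relation.Binary.PropositionalEquality using (_≡_; _≢_)
import Data.List.Membership.Propositional as L

-- A hypergraph is a finite list of edges; edges are subsets of a fixed
-- finite universe Fin n.  Its vertex set V is a subset of Fin n.
Hypergraph : ℕ → Set
Hypergraph n = List (Subset n)

IsHypergraphOn : ∀ {n} → Subset n → Hypergraph n → Set
IsHypergraphOn V ℋ =
  (∀ {H} → H L.∈ ℋ → Nonempty H × H ⊆ V) ×
  (∀ {x} → x ∈ V → ∃ λ H → H L.∈ ℋ × x ∈ H)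

Meets : ∀ {n} → Subset n → Subset n → Set
Meets A B = Nonempty (A ∩ B)

HasTransversalIn : ∀ {n} → Hypergraph n → Subset n → Set
HasTransversalIn ℋ S =
  ∃ λ H → H L.∈ ℋ × H ⊆ S × (∀ {H'} → H' L.∈ ℋ → H' ⊆ S → Meets H H')

HasTransversal : ∀ {n} → Hypergraph n → Set
HasTransversal ℋ = ∃ λ H → H L.∈ ℋ × (∀ {H'} → H' L.∈ ℋ → Meets H H')

SubNonempty : ∀ {n} → Hypergraph n → Subset n → Set
SubNonempty ℋ S = ∃ λ H → H L.∈ ℋ × H ⊆ S

PropertyA : ∀ {n} → Subset n → Hypergraph n → Set
PropertyA V ℋ =
  ¬ HasTransversal ℋ ×
  (∀ S → S ⊆ V → S ≢ V → SubNonempty ℋ S → HasTransversalIn ℋ S)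

_⊗_ : ∀ {n} → Hypergraph n → Hypergraph n → Hypergraph n
ℋ₁ ⊗ ℋ₂ = concatMap (λ H₁ → map (H₁ ∪_) ℋ₂) ℋ₁

-- Edges of ℋ¹ ⊗ ℋ² are unions H¹ ∪ H², and since V₁ and V₂ are disjoint,
-- H¹ ∪ H² meets H'¹ ∪ H'² only if H¹ meets H'¹ or H² meets H'². As ℋⁱ has no
-- transversal edge, some H'ⁱ ∈ ℋⁱ misses Hⁱ, so H'¹ ∪ H'² misses H¹ ∪ H².
-- For a proper S ⊂ V₁ ∪ V₂, say S ∩ V₁ ⊂ V₁, a transversal edge T of ℋ¹
-- restricted to S ∩ V₁ and any edge H² ⊆ S of ℋ² give the transversal edge
-- T ∪ H² of the compound restricted to S.
module Submission where

open import Defs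
open import Data.Nat using (ℕ)
open import Data.Fin.Subset using (Subset; _∩_; _∪_; Empty; _∈_; _⊆_)
open import Data.Fin.Subset.Properties
  using (x∈p∩q⁺; x∈p∩q⁻; x∈p∪q⁻; p⊆p∪q; q⊆p∪q; p∩q⊆p; p∩q⊆q; ∪-comm; ⊆-antisym; nonempty?)
open import Data.List using ([]; _∷_; map; _++_; cartesianProductWith)
import Data.List.Membership.Propositional as L
open import Data.List.Membership.Propositional.Properties
  using (∈-cartesianProductWith⁺; ∈-cartesianProductWith⁻)
open import Data.List.Relation.Unary.All as All using (all?)
open import Data.List.Relation.Unary.All.Properties using (¬All⇒Any¬)
open import Data.Product using (∃; ∃₂; _×_; _,_; proj₂)
open import Data.Sum using (_⊎_; inj₁; inj₂; [_,_])
open import Data.Empty using (⊥-elim)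
open import Data.Bool using () renaming (_≟_ to _≟ᵇ_)
open import Data.Vec.Properties using (≡-dec)
open import Relation.Nullary using (¬_; yes; no)
open import Relation.Binary.Definitions using (Decidable)
open import Relation.Binary.PropositionalEquality using (_≡_; _≢_; refl; sym; cong; subst)

private
  variable
    n : ℕ
    A A′ B B′ H H₁ H₂ S V V₁ V₂ : Subset n
    ℋ ℋ₁ ℋ₂ : Hypergraph n

EdgesWithin : Subset n → Hypergraph n → Set
EdgesWithin V ℋ = ∀ {H} → H L.∈ ℋ → H ⊆ V

edgesWithin : IsHypergraphOn V ℋ → EdgesWithin V ℋ
edgesWithin (edges , _) H∈ℋ = proj₂ (edges H∈ℋ)

infix 4 _≟_
_≟_ : Decidable {A = Subset n} _≡_
_≟_ = ≡-dec _≟ᵇ_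

∩≡⇒⊆ : S ∩ V ≡ V → V ⊆ S
∩≡⇒⊆ {S = S} {V = V} S∩V≡V x∈V = p∩q⊆p S V (subst (_ ∈_) (sym S∩V≡V) x∈V)

proper-split : S ⊆ V₁ ∪ V₂ → S ≢ V₁ ∪ V₂ → S ∩ V₁ ≢ V₁ ⊎ S ∩ V₂ ≢ V₂
proper-split {S = S} {V₁ = V₁} {V₂ = V₂} S⊆V S≢V with S ∩ V₁ ≟ V₁ | S ∩ V₂ ≟ V₂
... | no ≢₁  | _       = inj₁ ≢₁
... | yes _  | no ≢₂   = inj₂ ≢₂
... | yes ≡₁ | yes ≡₂  = ⊥-elim (S≢V (⊆-antisym S⊆V V⊆S))
  where
  V⊆S : V₁ ∪ V₂ ⊆ S
  V⊆S x∈V = [ ∩≡⇒⊆ ≡₁ , ∩≡⇒⊆ ≡₂ ] (x∈p∪q⁻ V₁ V₂ x∈V)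

meets? : Decidable {A = Subset n} Meets
meets? A B = nonempty? (A ∩ B)

Meets-mono : A ⊆ A′ → B ⊆ B′ → Meets A B → Meets A′ B′
Meets-mono {A = A} {B = B} A⊆A′ B⊆B′ (x , x∈A∩B) =
  let x∈A , x∈B = x∈p∩q⁻ A B x∈A∩B in x , x∈p∩q⁺ (A⊆A′ x∈A , B⊆B′ x∈B)

separated⇒¬Meets : Empty (V₁ ∩ V₂) → A ⊆ V₁ → B ⊆ V₂ → ¬ Meets A B
separated⇒¬Meets {A = A} {B = B} V₁∩V₂≡∅ A⊆V₁ B⊆V₂ (x , x∈A∩B) =
  let x∈A , x∈B = x∈p∩q⁻ A B x∈A∩B in V₁∩V₂≡∅ (x , x∈p∩q⁺ (A⊆V₁ x∈A , B⊆V₂ x∈B))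

Meets-∪-separated : ∀ {A₁ A₂ B₁ B₂ : Subset n} → Empty (V₁ ∩ V₂) →
  A₁ ⊆ V₁ → B₁ ⊆ V₁ → A₂ ⊆ V₂ → B₂ ⊆ V₂ →
  Meets (A₁ ∪ A₂) (B₁ ∪ B₂) → Meets A₁ B₁ ⊎ Meets A₂ B₂
Meets-∪-separated {A₁ = A₁} {A₂} {B₁} {B₂} V₁∩V₂≡∅ A₁⊆V₁ B₁⊆V₁ A₂⊆V₂ B₂⊆V₂ (x , x∈A∩B)
  with x∈A , x∈B ← x∈p∩q⁻ (A₁ ∪ A₂) (B₁ ∪ B₂) x∈A∩B
  with x∈p∪q⁻ A₁ A₂ x∈A | x∈p∪q⁻ B₁ B₂ x∈B
... | inj₁ x∈A₁ | inj₁ x∈B₁ = inj₁ (x , x∈p∩q⁺ (x∈A₁ , x∈B₁))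
... | inj₂ x∈A₂ | inj₂ x∈B₂ = inj₂ (x , x∈p∩q⁺ (x∈A₂ , x∈B₂))
... | inj₁ x∈A₁ | inj₂ x∈B₂ = ⊥-elim (separated⇒¬Meets V₁∩V₂≡∅ A₁⊆V₁ B₂⊆V₂ (x , x∈p∩q⁺ (x∈A₁ , x∈B₂)))
... | inj₂ x∈A₂ | inj₁ x∈B₁ = ⊥-elim (separated⇒¬Meets V₁∩V₂≡∅ B₁⊆V₁ A₂⊆V₂ (x , x∈p∩q⁺ (x∈B₁ , x∈A₂)))

¬HasTransversal⇒avoidingEdge : ¬ HasTransversal ℋ → H L.∈ ℋ → ∃ λ H′ → H′ L.∈ ℋ × ¬ Meets H H′
¬HasTransversal⇒avoidingEdge {ℋ = ℋ} {H = H} ¬tr H∈ℋ with all? (meets? H) ℋ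
... | yes meetsAll = ⊥-elim (¬tr (H , H∈ℋ , All.lookup meetsAll))
... | no ¬meetsAll = L.find (¬All⇒Any¬ (meets? H) ℋ ¬meetsAll)

⊗≡cartesianProductWith : (ℋ₁ ℋ₂ : Hypergraph n) → ℋ₁ ⊗ ℋ₂ ≡ cartesianProductWith _∪_ ℋ₁ ℋ₂
⊗≡cartesianProductWith []       ℋ₂ = refl
⊗≡cartesianProductWith (H ∷ ℋ₁) ℋ₂ = cong (map (H ∪_) ℋ₂ ++_) (⊗≡cartesianProductWith ℋ₁ ℋ₂)

∈-⊗⁺ : H₁ L.∈ ℋ₁ → H₂ L.∈ ℋ₂ → H₁ ∪ H₂ L.∈ ℋ₁ ⊗ ℋ₂
∈-⊗⁺ {ℋ₁ = ℋ₁} {ℋ₂ = ℋ₂} H₁∈ℋ₁ H₂∈ℋ₂ =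
  subst (_ L.∈_) (sym (⊗≡cartesianProductWith ℋ₁ ℋ₂)) (∈-cartesianProductWith⁺ _∪_ H₁∈ℋ₁ H₂∈ℋ₂)

∈-⊗⁻ : (ℋ₁ ℋ₂ : Hypergraph n) → H L.∈ ℋ₁ ⊗ ℋ₂ → ∃₂ λ H₁ H₂ → H₁ L.∈ ℋ₁ × H₂ L.∈ ℋ₂ × H ≡ H₁ ∪ H₂
∈-⊗⁻ ℋ₁ ℋ₂ H∈ℋ =
  ∈-cartesianProductWith⁻ _∪_ ℋ₁ ℋ₂ (subst (_ L.∈_) (⊗≡cartesianProductWith ℋ₁ ℋ₂) H∈ℋ)

∈-⊗-comm : (ℋ₁ ℋ₂ : Hypergraph n) → H L.∈ ℋ₁ ⊗ ℋ₂ → H L.∈ ℋ₂ ⊗ ℋ₁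
∈-⊗-comm ℋ₁ ℋ₂ H∈ℋ with H₁ , H₂ , H₁∈ℋ₁ , H₂∈ℋ₂ , refl ← ∈-⊗⁻ ℋ₁ ℋ₂ H∈ℋ =
  subst (L._∈ _) (∪-comm H₂ H₁) (∈-⊗⁺ H₂∈ℋ₂ H₁∈ℋ₁)

HasTransversalIn-⊗-comm : (ℋ₁ ℋ₂ : Hypergraph n) → HasTransversalIn (ℋ₁ ⊗ ℋ₂) S → HasTransversalIn (ℋ₂ ⊗ ℋ₁) S
HasTransversalIn-⊗-comm ℋ₁ ℋ₂ (T , T∈ℋ , T⊆S , meets) =
  T , ∈-⊗-comm ℋ₁ ℋ₂ T∈ℋ , T⊆S , λ H∈ℋ H⊆S → meets (∈-⊗-comm ℋ₂ ℋ₁ H∈ℋ) H⊆S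

SubNonempty-⊗⁻ : (ℋ₁ ℋ₂ : Hypergraph n) → SubNonempty (ℋ₁ ⊗ ℋ₂) S → SubNonempty ℋ₁ S × SubNonempty ℋ₂ S
SubNonempty-⊗⁻ ℋ₁ ℋ₂ (H , H∈ℋ , H⊆S) with H₁ , H₂ , H₁∈ℋ₁ , H₂∈ℋ₂ , refl ← ∈-⊗⁻ ℋ₁ ℋ₂ H∈ℋ =
  (H₁ , H₁∈ℋ₁ , λ x∈H₁ → H⊆S (p⊆p∪q H₂ x∈H₁)) , (H₂ , H₂∈ℋ₂ , λ x∈H₂ → H⊆S (q⊆p∪q H₁ H₂ x∈H₂))

SubNonempty-∩ : EdgesWithin V ℋ → SubNonempty ℋ S → SubNonempty ℋ (S ∩ V)
SubNonempty-∩ within (H , H∈ℋ , H⊆S) = H , H∈ℋ , λ x∈H → x∈p∩q⁺ (H⊆S x∈H , within H∈ℋ x∈H)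

⊗-¬HasTransversal : Empty (V₁ ∩ V₂) → EdgesWithin V₁ ℋ₁ → EdgesWithin V₂ ℋ₂ →
  ¬ HasTransversal ℋ₁ → ¬ HasTransversal ℋ₂ → ¬ HasTransversal (ℋ₁ ⊗ ℋ₂)
⊗-¬HasTransversal {ℋ₁ = ℋ₁} {ℋ₂ = ℋ₂} V₁∩V₂≡∅ within₁ within₂ ¬tr₁ ¬tr₂ (H , H∈ℋ , meets)
  with H₁ , H₂ , H₁∈ℋ₁ , H₂∈ℋ₂ , refl ← ∈-⊗⁻ ℋ₁ ℋ₂ H∈ℋ
  with H₁′ , H₁′∈ℋ₁ , ¬meets₁ ← ¬HasTransversal⇒avoidingEdge ¬tr₁ H₁∈ℋ₁
  with H₂′ , H₂′∈ℋ₂ , ¬meets₂ ← ¬HasTransversal⇒avoidingEdge ¬tr₂ H₂∈ℋ₂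
  with Meets-∪-separated V₁∩V₂≡∅ (within₁ H₁∈ℋ₁) (within₁ H₁′∈ℋ₁) (within₂ H₂∈ℋ₂) (within₂ H₂′∈ℋ₂)
         (meets (∈-⊗⁺ H₁′∈ℋ₁ H₂′∈ℋ₂))
... | inj₁ meets₁ = ¬meets₁ meets₁
... | inj₂ meets₂ = ¬meets₂ meets₂

⊗-HasTransversalInˡ : EdgesWithin V₁ ℋ₁ → HasTransversalIn ℋ₁ (S ∩ V₁) → SubNonempty ℋ₂ S →
  HasTransversalIn (ℋ₁ ⊗ ℋ₂) S
⊗-HasTransversalInˡ {V₁ = V₁} {ℋ₁ = ℋ₁} {S = S} {ℋ₂ = ℋ₂} within₁ (T , T∈ℋ₁ , T⊆S∩V₁ , meets) (H₂ , H₂∈ℋ₂ , H₂⊆S) =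
  T ∪ H₂ , ∈-⊗⁺ T∈ℋ₁ H₂∈ℋ₂ , T∪H₂⊆S , meetsAll
  where
  T∪H₂⊆S : T ∪ H₂ ⊆ S
  T∪H₂⊆S x∈T∪H₂ = [ (λ x∈T → p∩q⊆p S V₁ (T⊆S∩V₁ x∈T)) , H₂⊆S ] (x∈p∪q⁻ T H₂ x∈T∪H₂)

  meetsAll : ∀ {H} → H L.∈ ℋ₁ ⊗ ℋ₂ → H ⊆ S → Meets (T ∪ H₂) H
  meetsAll H∈ℋ H⊆S with A , B , A∈ℋ₁ , _ , refl ← ∈-⊗⁻ ℋ₁ ℋ₂ H∈ℋ =
    Meets-mono (p⊆p∪q H₂) (p⊆p∪q B)
      (meets A∈ℋ₁ λ x∈A → x∈p∩q⁺ (H⊆S (p⊆p∪q B x∈A) , within₁ A∈ℋ₁ x∈A))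

⊗-HasTransversalInʳ : EdgesWithin V₂ ℋ₂ → SubNonempty ℋ₁ S → HasTransversalIn ℋ₂ (S ∩ V₂) →
  HasTransversalIn (ℋ₁ ⊗ ℋ₂) S
⊗-HasTransversalInʳ {ℋ₂ = ℋ₂} {ℋ₁ = ℋ₁} within₂ ne₁ tr₂ =
  HasTransversalIn-⊗-comm ℋ₂ ℋ₁ (⊗-HasTransversalInˡ within₂ tr₂ ne₁)

lemma7 : ∀ {n} (V₁ V₂ : Subset n) (ℋ₁ ℋ₂ : Hypergraph n) →
    Empty (V₁ ∩ V₂) →
    IsHypergraphOn V₁ ℋ₁ → IsHypergraphOn V₂ ℋ₂ →
    PropertyA V₁ ℋ₁ → PropertyA V₂ ℋ₂ →
    PropertyA (V₁ ∪ V₂) (ℋ₁ ⊗ ℋ₂)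
lemma7 V₁ V₂ ℋ₁ ℋ₂ V₁∩V₂≡∅ hyp₁ hyp₂ (¬tr₁ , tr₁) (¬tr₂ , tr₂) =
  ⊗-¬HasTransversal V₁∩V₂≡∅ within₁ within₂ ¬tr₁ ¬tr₂ , trIn
  where
  within₁ = edgesWithin hyp₁
  within₂ = edgesWithin hyp₂

  trIn : ∀ S → S ⊆ V₁ ∪ V₂ → S ≢ V₁ ∪ V₂ → SubNonempty (ℋ₁ ⊗ ℋ₂) S → HasTransversalIn (ℋ₁ ⊗ ℋ₂) S
  trIn S S⊆V S≢V ne with ne₁ , ne₂ ← SubNonempty-⊗⁻ ℋ₁ ℋ₂ ne | proper-split S⊆V S≢V
  ... | inj₁ S∩V₁≢V₁ =
    ⊗-HasTransversalInˡ within₁ (tr₁ (S ∩ V₁) (p∩q⊆q S V₁) S∩V₁≢V₁ (SubNonempty-∩ within₁ ne₁)) ne₂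
  ... | inj₂ S∩V₂≢V₂ =
    ⊗-HasTransversalInʳ within₂ ne₁ (tr₂ (S ∩ V₂) (p∩q⊆q S V₂) S∩V₂≢V₂ (SubNonempty-∩ within₂ ne₂))
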